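{- Let $\eta$ be an inheritable and heavy basic hyperparameter, let $d$ be an integer, and let $\rho=\mu_{\eta,d}$ be the $(\eta,d)$-modulator number (with its canonical hyperparameterisation). Then $\rho$ is inheritable and heavy, and $\mathcal B_{\alpha\text{ - }\rho}=\bigcup_c\mathcal B_{\alpha\text{ - }\mu_{\rho,c}}$ and $\mathcal C_\rho=\bigcup_c\mathcal C_{\mu_{\rho,c}}$, where the unions are over all integers $c$.
   Context: All graphs are finite, simple and undirected; $\alpha,\omega$ denote independence and clique number. A graph class is a set of graphs closed under isomorphism. A hypergraph over $G$ is a nonempty set of subsets of $V(G)$; a hypermapping $\mathcal F$ assigns to each graph $G$ a finite nonempty family $\mathcal F_G$ of hypergraphs over $G$, compatibly with isomorphisms. For $\lambda\in\{\mathtt{card},\alpha\}$ with $\mathtt{card}(G,X)=|X|$, $\alpha(G,X)=\alpha(G[X])$, and a basic hyperparameter $\rho=(\mathrm{opt},\mathcal F)$ with $\mathrm{opt}\in\{\mathrm{minmax},\mathrm{maxmin}\}$, define $\lambda\text{ - }\rho(G)=\min_{H\in\mathcal F_G}\max_{X\in H}\lambda(G,X)$ (minmax) or $\max_{H\in\mathcal F_G}\min_{X\in H}\lambda(G,X)$ (maxmin); $\rho(G)=\mathtt{card}\text{ - }\rho(G)$. $\rho$ is inheritable if for each $\lambda\in\{\mathtt{card},\alpha\}$, every $G$ and every $S\subseteq V(G)$, $\lambda\text{ - }\rho(G)\le\rho(G-S)+\lambda(G,S)$. $\rho$ is heavy if $G\mapsto\rho(G)$ is monotone under induced subgraphs and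 unbounded on complete graphs. For a graph parameter $\sigma$ and integer $c$, a $(\sigma,c)$-modulator of $G$ is a set $S$ with $\sigma(G-S)\le c$; $\mu_{\sigma,c}(G)$ is the minimum $|S|$ over such $S$; its canonical hyperparameterisation is $\mathrm{opt}=\mathrm{maxmin}$, $\mathcal F_G=\{\{S\subseteq V(G):\sigma(G-S)\le c\}\}$, so $\alpha\text{ - }\mu_{\sigma,c}(G)$ is the minimum $\alpha(G[S])$ over such $S$. For a parameter $\sigma$, $\mathcal B_\sigma$ is the family of graph classes $\mathcal G$ with bounded $\sigma$ (there is an integer $k$ with $\sigma(G')\le k$ for every induced subgraph $G'$ of every $G\in\mathcal G$), and $\mathcal C_\sigma$ the family of graph classes with clique-bounded $\sigma$ (there is a nondecreasing $f$ with $\sigma(G')\le f(\omega(G'))$ for all such $G'$). -}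

module Defs where

open import Data.Nat using (ℕ; zero; suc; _≤_; _<_; _⊔_; _⊓_; _≤?_)
open import Data.Bool using (Bool; true; false; _∧_; not; if_then_else_)
open import Data.Fin using (Fin; zero; suc; _≟_)
open import Data.Vec using (Vec; []; _∷_; lookup; tabulate; replicate)
import Data.Vec as Vec
open import Data.List using (List; []; _∷_; _++_; filter; allFin; foldr)
import Data.List as List
open import Data.List.NonEmpty using (List⁺; _∷_; foldr₁; toList)
import Data.List.NonEmpty as List⁺
open import Data.List.Membership.Propositional using (_∈_)
open import Data.Product using (Σ; ∃; _×_; _,_)
open import Relation.Binary.PropositionalEquality using (_≡_; _≢_)
open import Relation.Nullary using (does)
open import Function.Bundles using (_↔_; Inverse; _⇔_)

record Graph (n : ℕ) : Set where
  field
    adj    : Fin n → Fin n → Bool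
    sym    : ∀ i j → adj i j ≡ adj j i
    irrefl : ∀ i → adj i i ≡ false
open Graph public

Subset : ℕ → Set
Subset n = Vec Bool n

size : ∀ {n} → Subset n → ℕ
size [] = 0
size (true ∷ S) = suc (size S)
size (false ∷ S) = size S

enum : ∀ {n} (S : Subset n) → Fin (size S) → Fin n
enum (true ∷ S) zero = zero
enum (true ∷ S) (suc i) = suc (enum S i)
enum (false ∷ S) i = suc (enum S i)

fullSet : ∀ {n} → Subset n
fullSet = replicate _ true

complement : ∀ {n} → Subset n → Subset n
complement = Vec.map not

induced : ∀ {n} → Graph n → (S : Subset n) → Graph (size S)
induced G S = record
  { adj = λ i j → adj G (enum S i) (enum S j)
  ; sym = λ i j → sym G (enum S i) (enum S j)
  ; irrefl = λ i → irrefl G (enum S i) }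

_─_ : ∀ {n} → Graph n → (S : Subset n) → Graph (size (complement S))
G ─ S = induced G (complement S)

allSubsets : ∀ n → List (Subset n)
allSubsets zero = [] ∷ []
allSubsets (suc n) = List.map (false ∷_) (allSubsets n) ++ List.map (true ∷_) (allSubsets n)

allB : ∀ {A : Set} → (A → Bool) → List A → Bool
allB p = foldr (λ x b → p x ∧ b) true

isIndependent : ∀ {n} → Graph n → Subset n → Bool
isIndependent {n} G S =
  allB (λ i → allB (λ j → not (lookup S i ∧ lookup S j ∧ adj G i j)) (allFin n)) (allFin n)

isClique : ∀ {n} → Graph n → Subset n → Bool
isClique {n} G S =
  allB (λ i → allB (λ j → not (lookup S i ∧ lookup S j ∧ not (does (i ≟ j)) ∧ not (adj G i j))) (allFin n)) (allFin n)

maxList : List ℕ → ℕ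
maxList = foldr _⊔_ 0

α : ∀ {n} → Graph n → ℕ
α {n} G = maxList (List.map (λ S → if isIndependent G S then size S else 0) (allSubsets n))

ω : ∀ {n} → Graph n → ℕ
ω {n} G = maxList (List.map (λ S → if isClique G S then size S else 0) (allSubsets n))

IsComplete : ∀ {n} → Graph n → Set
IsComplete {n} G = ∀ (i j : Fin n) → i ≢ j → adj G i j ≡ true

Param : Set
Param = ∀ {n} → Graph n → ℕ

record _≅_ {n} (G G' : Graph n) : Set where
  field
    π        : Fin n ↔ Fin n
    preserve : ∀ i j → adj G i j ≡ adj G' (Inverse.to π i) (Inverse.to π j)
open _≅_ public

imageSub : ∀ {n} → (Fin n ↔ Fin n) → Subset n → Subset n
imageSub π X = tabulate (λ j → lookup X (Inverse.from π j))

Hypergraph : ℕ → Set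
Hypergraph n = List⁺ (Subset n)

SameSet : ∀ {n} → Hypergraph n → Hypergraph n → Set
SameSet H H' = (∀ {X} → X ∈ toList H → X ∈ toList H') × (∀ {X} → X ∈ toList H' → X ∈ toList H)

data Opt : Set where
  minmax maxmin : Opt

record BasicHyperparameter : Set where
  field
    opt : Opt
    F   : ∀ {n} → Graph n → List⁺ (Hypergraph n)
open BasicHyperparameter public

IsoCompatible : BasicHyperparameter → Set
IsoCompatible ρ = ∀ {n} {G G' : Graph n} (φ : G ≅ G') →
  (∀ {H} → H ∈ toList (F ρ G) →
     Σ (Hypergraph n) λ H' → H' ∈ toList (F ρ G') × SameSet H' (List⁺.map (imageSub (π φ)) H))
  × (∀ {H'} → H' ∈ toList (F ρ G') →
     Σ (Hypergraph n) λ H → H ∈ toList (F ρ G) × SameSet H' (List⁺.map (imageSub (π φ)) H))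

data Lam : Set where
  card alpha : Lam

evalLam : Lam → ∀ {n} → Graph n → Subset n → ℕ
evalLam card G X = size X
evalLam alpha G X = α (induced G X)

value : Lam → BasicHyperparameter → Param
value λ' ρ G with opt ρ
... | minmax = foldr₁ _⊓_ (List⁺.map (λ H → foldr₁ _⊔_ (List⁺.map (evalLam λ' G) H)) (F ρ G))
... | maxmin = foldr₁ _⊔_ (List⁺.map (λ H → foldr₁ _⊓_ (List⁺.map (evalLam λ' G) H)) (F ρ G))

val : BasicHyperparameter → Param
val = value card

Inheritable : BasicHyperparameter → Set
Inheritable ρ = ∀ (λ' : Lam) {n} (G : Graph n) (S : Subset n) →
  value λ' ρ G ≤ Data.Nat._+_ (val ρ (G ─ S)) (evalLam λ' G S)

Heavy : BasicHyperparameter → Set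
Heavy ρ = (∀ {n} (G : Graph n) (X : Subset n) → val ρ (induced G X) ≤ val ρ G)
        × (∀ (k : ℕ) → Σ ℕ λ n → Σ (Graph n) λ G → IsComplete G × k < val ρ G)

toList⁺ : ∀ {A : Set} → List A → A → List⁺ A
toList⁺ [] d = d ∷ []
toList⁺ (x ∷ xs) d = x ∷ xs

-- the set of all (σ,c)-modulators of G, {S ⊆ V(G) : σ(G - S) ≤ c}.
-- (The fallback V(G) is only used when no modulator exists, which never
-- happens for σ a hyperparameter value, since then σ(K_0) = 0 ≤ c.)
modulators : Param → ℕ → ∀ {n} → Graph n → Hypergraph n
modulators σ c {n} G = toList⁺ (filter (λ S → σ (G ─ S) ≤? c) (allSubsets n)) fullSet

μ : Param → ℕ → BasicHyperparameter
μ σ c = record { opt = maxmin ; F = λ G → modulators σ c G ∷ [] }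

record GraphClass : Set₁ where
  field
    mem       : ∀ {n} → Graph n → Set
    iso-closed : ∀ {n} {G G' : Graph n} → G ≅ G' → mem G → mem G'
open GraphClass public

Bounded : Param → GraphClass → Set
Bounded σ 𝒢 = Σ ℕ λ k → ∀ {n} (G : Graph n) → mem 𝒢 G → ∀ (X : Subset n) → σ (induced G X) ≤ k

CliqueBounded : Param → GraphClass → Set
CliqueBounded σ 𝒢 = Σ (ℕ → ℕ) λ f → (∀ {a b} → a ≤ b → f a ≤ f b)
  × (∀ {n} (G : Graph n) → mem 𝒢 G → ∀ (X : Subset n) → σ (induced G X) ≤ f (ω (induced G X)))

-- Write ρ = μ_{η,d}. If Y is a minimum (η, d)-modulator of G - S, then S ∪ Y is an
-- (η, d)-modulator of G, since G - (S ∪ Y) = (G - S) - Y; as |S ∪ Y| = |S| + |Y| and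
-- α(G[S ∪ Y]) ≤ α(G[S]) + |Y|, ρ is inheritable. A minimum modulator Y of G meets
-- G[X] in a modulator of G[X], since G[X] - Y is an induced subgraph of G - Y and η
-- is monotone; and inheritability of η gives η ≤ ρ + d, so ρ is unbounded on complete
-- graphs. For the classes: an (η, d)-modulator S of G is also a (ρ, 0)-modulator,
-- the empty set witnessing ρ(G - S) = 0, so λ-μ_{ρ,0} ≤ λ-ρ; conversely
-- inheritability of ρ gives λ-ρ ≤ c + λ-μ_{ρ,c}.
module Submission where

open import Algebra.Definitions using (Selective)
open import Defs hiding (sym)
open import Data.Nat using (ℕ; zero; suc; _≤_; _<_; _+_; _⊔_; _⊓_; _≤?_; z≤n; s≤s; pred)
open import Data.Nat.Properties
open import Data.Bool using (Bool; true; false; _∧_; not; if_then_else_)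
open import Data.Bool.Properties using (∧-comm; ∧-conicalˡ; ∧-conicalʳ)
open import Data.Fin using (Fin; zero; suc; cast)
open import Data.Fin.Properties using (cast-is-id)
open import Data.Vec using ([]; _∷_; lookup; replicate; zipWith)
open import Data.Vec.Properties using (tabulate∘lookup; zipWith-comm)
open import Data.List using (List; []; _∷_; filter; allFin)
import Data.List as List
open import Data.List.NonEmpty using (List⁺; _∷_; foldr₁; toList)
import Data.List.NonEmpty as List⁺
open import Data.List.NonEmpty.Properties using (map-cong; map-id)
open import Data.List.Membership.Propositional using (_∈_)
open import Data.List.Membership.Propositional.Properties
  using (∈-map⁺; ∈-map⁻; ∈-filter⁺; ∈-filter⁻; ∈-allFin; ∈-++⁺ˡ; ∈-++⁺ʳ)
open import Data.List.Relation.Unary.Any using (here; there)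
open import Data.Product using (Σ; _×_; _,_; proj₁; proj₂)
open import Data.Sum using (_⊎_; inj₁; inj₂)
open import Relation.Binary.PropositionalEquality
open import Function.Bundles using (_⇔_; mk⇔)
open import Function.Construct.Identity using (↔-id)

module _ {A : Set} (f : A → ℕ) where

  foldr₁-attained : ∀ {op} → Selective _≡_ op → (L : List⁺ A) →
    Σ A λ x → x ∈ toList L × foldr₁ op (List⁺.map f L) ≡ f x
  foldr₁-attained {op} sel (x ∷ xs) = go x xs
    where
    go : (x : A) (xs : List A) →
      Σ A λ z → z ∈ toList (x ∷ xs) × foldr₁ op (List⁺.map f (x ∷ xs)) ≡ f z
    go x [] = x , here refl , refl
    go x (y ∷ ys) with go y ys | sel (f x) (foldr₁ op (List⁺.map f (y ∷ ys)))
    ... | _ , _ , _ | inj₁ first = x , here refl , first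
    ... | z , z∈ , rest≡ | inj₂ rest = z , there z∈ , trans rest rest≡

  foldr₁-≤ : ∀ {op} → Selective _≡_ op → (L : List⁺ A) {m : ℕ} →
    (∀ x → f x ≤ m) → foldr₁ op (List⁺.map f L) ≤ m
  foldr₁-≤ sel L {m} f≤m with foldr₁-attained sel L
  ... | x , _ , eq = subst (_≤ m) (sym eq) (f≤m x)

  foldr₁-⊓-≤ : (L : List⁺ A) {x : A} → x ∈ toList L → foldr₁ _⊓_ (List⁺.map f L) ≤ f x
  foldr₁-⊓-≤ (x ∷ []) (here refl) = ≤-refl
  foldr₁-⊓-≤ (x ∷ y ∷ ys) (here refl) = m⊓n≤m _ _
  foldr₁-⊓-≤ (x ∷ y ∷ ys) (there x∈) = ≤-trans (m⊓n≤n _ _) (foldr₁-⊓-≤ (y ∷ ys) x∈)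

  ≤-foldr₁-⊔ : (L : List⁺ A) {x : A} → x ∈ toList L → f x ≤ foldr₁ _⊔_ (List⁺.map f L)
  ≤-foldr₁-⊔ (x ∷ []) (here refl) = ≤-refl
  ≤-foldr₁-⊔ (x ∷ y ∷ ys) (here refl) = m≤m⊔n _ _
  ≤-foldr₁-⊔ (x ∷ y ∷ ys) (there x∈) = ≤-trans (≤-foldr₁-⊔ (y ∷ ys) x∈) (m≤n⊔m _ _)

  foldr₁-⊔-mono-⊆ : ∀ {L L' : List⁺ A} → (∀ {x} → x ∈ toList L → x ∈ toList L') →
    foldr₁ _⊔_ (List⁺.map f L) ≤ foldr₁ _⊔_ (List⁺.map f L')
  foldr₁-⊔-mono-⊆ {L} {L'} L⊆L' with foldr₁-attained ⊔-sel L
  ... | x , x∈ , eq = subst (_≤ _) (sym eq) (≤-foldr₁-⊔ L' (L⊆L' x∈))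

  foldr₁-⊓-antimono-⊆ : ∀ {L L' : List⁺ A} → (∀ {x} → x ∈ toList L → x ∈ toList L') →
    foldr₁ _⊓_ (List⁺.map f L') ≤ foldr₁ _⊓_ (List⁺.map f L)
  foldr₁-⊓-antimono-⊆ {L} {L'} L⊆L' with foldr₁-attained ⊓-sel L
  ... | x , x∈ , eq = subst (_ ≤_) (sym eq) (foldr₁-⊓-≤ L' (L⊆L' x∈))

≤-maxList : ∀ {x} xs → x ∈ xs → x ≤ maxList xs
≤-maxList (y ∷ ys) (here refl) = m≤m⊔n _ _
≤-maxList (y ∷ ys) (there x∈) = ≤-trans (≤-maxList ys x∈) (m≤n⊔m _ _)

maxList-≤ : ∀ xs {k} → (∀ {x} → x ∈ xs → x ≤ k) → maxList xs ≤ k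
maxList-≤ [] _ = z≤n
maxList-≤ (y ∷ ys) ≤k = ⊔-lub (≤k (here refl)) (maxList-≤ ys (λ x∈ → ≤k (there x∈)))

size≤ : ∀ {n} (X : Subset n) → size X ≤ n
size≤ [] = z≤n
size≤ (true ∷ X) = s≤s (size≤ X)
size≤ (false ∷ X) = m≤n⇒m≤1+n (size≤ X)

∈-allSubsets : ∀ {n} (X : Subset n) → X ∈ allSubsets n
∈-allSubsets [] = here refl
∈-allSubsets (false ∷ X) = ∈-++⁺ˡ (∈-map⁺ (false ∷_) (∈-allSubsets X))
∈-allSubsets (true ∷ X) =
  ∈-++⁺ʳ (List.map (false ∷_) (allSubsets _)) (∈-map⁺ (true ∷_) (∈-allSubsets X))

size-complement-fullSet : ∀ n → size (complement (fullSet {n})) ≡ 0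
size-complement-fullSet zero = refl
size-complement-fullSet (suc n) = size-complement-fullSet n

emptySet : ∀ n → Subset n
emptySet n = replicate n false

size-emptySet : ∀ n → size (emptySet n) ≡ 0
size-emptySet zero = refl
size-emptySet (suc n) = size-emptySet n

val-≤-order : (σ : BasicHyperparameter) {n : ℕ} (G : Graph n) → val σ G ≤ n
val-≤-order σ G with opt σ
... | minmax = foldr₁-≤ _ ⊓-sel (F σ G) λ H → foldr₁-≤ size ⊔-sel H size≤
... | maxmin = foldr₁-≤ _ ⊔-sel (F σ G) λ H → foldr₁-≤ size ⊓-sel H size≤

fullSet-isModulator : (σ : BasicHyperparameter) (c : ℕ) {n : ℕ} (G : Graph n) →
  val σ (G ─ fullSet) ≤ c
fullSet-isModulator σ c {n} G =
  ≤-trans (val-≤-order σ (G ─ fullSet)) (subst (_≤ c) (sym (size-complement-fullSet n)) z≤n)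

∈-toList⁺⁺ : ∀ {A : Set} {L : List A} {d x : A} → x ∈ L → x ∈ toList (toList⁺ L d)
∈-toList⁺⁺ {L = _ ∷ _} x∈ = x∈

∈-toList⁺⁻ : ∀ {A : Set} (L : List A) {d x : A} → x ∈ toList (toList⁺ L d) → x ∈ L ⊎ x ≡ d
∈-toList⁺⁻ [] (here refl) = inj₂ refl
∈-toList⁺⁻ (_ ∷ _) x∈ = inj₁ x∈

module _ (σ : Param) (c : ℕ) {n : ℕ} (G : Graph n) where

  ∈-modulators⁺ : ∀ {X} → σ (G ─ X) ≤ c → X ∈ toList (modulators σ c G)
  ∈-modulators⁺ {X} σ≤c = ∈-toList⁺⁺ (∈-filter⁺ (λ S → σ (G ─ S) ≤? c) (∈-allSubsets X) σ≤c)

  -- The hypothesis covers fullSet, which modulators returns when no subset qualifies.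
  ∈-modulators⁻ : σ (G ─ fullSet) ≤ c → ∀ {X} → X ∈ toList (modulators σ c G) → σ (G ─ X) ≤ c
  ∈-modulators⁻ full≤c X∈ with ∈-toList⁺⁻ (filter (λ S → σ (G ─ S) ≤? c) (allSubsets n)) X∈
  ... | inj₁ X∈ = proj₂ (∈-filter⁻ (λ S → σ (G ─ S) ≤? c) {xs = allSubsets n} X∈)
  ... | inj₂ refl = full≤c

  μ-≤ : ∀ λ' {X} → σ (G ─ X) ≤ c → value λ' (μ σ c) G ≤ evalLam λ' G X
  μ-≤ λ' σ≤c = foldr₁-⊓-≤ (evalLam λ' G) (modulators σ c G) (∈-modulators⁺ σ≤c)

  μ-attained : ∀ λ' → σ (G ─ fullSet) ≤ c →
    Σ (Subset n) λ X → σ (G ─ X) ≤ c × value λ' (μ σ c) G ≡ evalLam λ' G X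
  μ-attained λ' full≤c with foldr₁-attained (evalLam λ' G) ⊓-sel (modulators σ c G)
  ... | X , X∈ , eq = X , ∈-modulators⁻ full≤c X∈ , eq

allB-sound : ∀ {A : Set} (p : A → Bool) xs → allB p xs ≡ true → ∀ {x} → x ∈ xs → p x ≡ true
allB-sound p (y ∷ ys) all (here refl) = ∧-conicalˡ (p y) _ all
allB-sound p (y ∷ ys) all (there x∈) = allB-sound p ys (∧-conicalʳ (p y) _ all) x∈

allB-complete : ∀ {A : Set} (p : A → Bool) xs → (∀ x → p x ≡ true) → allB p xs ≡ true
allB-complete p [] _ = refl
allB-complete p (y ∷ ys) every rewrite every y = allB-complete p ys every

Independent : ∀ {m} → Graph m → Subset m → Set
Independent G I = ∀ i j → lookup I i ≡ true → lookup I j ≡ true → adj G i j ≡ false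

not-∧-∧⇒ : ∀ a b c → not (a ∧ b ∧ c) ≡ true → a ≡ true → b ≡ true → c ≡ false
not-∧-∧⇒ true true false _ _ _ = refl

⇒not-∧-∧ : ∀ a b c → (a ≡ true → b ≡ true → c ≡ false) → not (a ∧ b ∧ c) ≡ true
⇒not-∧-∧ false b c _ = refl
⇒not-∧-∧ true false c _ = refl
⇒not-∧-∧ true true c c≡false rewrite c≡false refl refl = refl

isIndependent-sound : ∀ {m} (G : Graph m) I → isIndependent G I ≡ true → Independent G I
isIndependent-sound {m} G I indep i j Ii Ij =
  not-∧-∧⇒ (lookup I i) (lookup I j) (adj G i j)
    (allB-sound _ (allFin m) (allB-sound _ (allFin m) indep (∈-allFin i)) (∈-allFin j)) Ii Ij

isIndependent-complete : ∀ {m} (G : Graph m) I → Independent G I → isIndependent G I ≡ true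
isIndependent-complete {m} G I indep =
  allB-complete _ (allFin m) λ i → allB-complete _ (allFin m) λ j →
    ⇒not-∧-∧ (lookup I i) (lookup I j) (adj G i j) (indep i j)

module _ {m : ℕ} (G : Graph m) where

  private
    sizeIfIndependent : Subset m → ℕ
    sizeIfIndependent S = if isIndependent G S then size S else 0

  size≤α : ∀ I → Independent G I → size I ≤ α G
  size≤α I indep = subst (_≤ α G) sizeIfIndependent≡size
    (≤-maxList _ (∈-map⁺ sizeIfIndependent (∈-allSubsets I)))
    where
    sizeIfIndependent≡size : sizeIfIndependent I ≡ size I
    sizeIfIndependent≡size rewrite isIndependent-complete G I indep = refl

  α-≤ : ∀ {k} → (∀ I → Independent G I → size I ≤ k) → α G ≤ k
  α-≤ {k} bound = maxList-≤ (List.map sizeIfIndependent (allSubsets m)) λ x∈ →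
    let S , _ , x≡ = ∈-map⁻ sizeIfIndependent x∈ in subst (_≤ k) (sym x≡) (≤k S)
    where
    ≤k : ∀ S → sizeIfIndependent S ≤ k
    ≤k S with isIndependent G S in indep
    ... | true = bound S (isIndependent-sound G S indep)
    ... | false = z≤n

-- extend S Y is S ∪ Y for a subset Y of the vertices of G ─ S.
extend : ∀ {n} (S : Subset n) → Subset (size (complement S)) → Subset n
extend [] [] = []
extend (true ∷ S) Y = true ∷ extend S Y
extend (false ∷ S) (y ∷ Y) = y ∷ extend S Y

size-extend : ∀ {n} (S : Subset n) Y → size (extend S Y) ≡ size S + size Y
size-extend [] [] = refl
size-extend (true ∷ S) Y = cong suc (size-extend S Y)
size-extend (false ∷ S) (true ∷ Y) = trans (cong suc (size-extend S Y)) (sym (+-suc _ _))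
size-extend (false ∷ S) (false ∷ Y) = size-extend S Y

-- For I ⊆ S ∪ Y, the part I ∩ S as a subset of S, and the inclusion of S into S ∪ Y.
restrictToBase : ∀ {n} (S : Subset n) Y → Subset (size (extend S Y)) → Subset (size S)
restrictToBase [] [] I = []
restrictToBase (true ∷ S) Y (i ∷ I) = i ∷ restrictToBase S Y I
restrictToBase (false ∷ S) (true ∷ Y) (i ∷ I) = restrictToBase S Y I
restrictToBase (false ∷ S) (false ∷ Y) I = restrictToBase S Y I

baseIndex : ∀ {n} (S : Subset n) Y → Fin (size S) → Fin (size (extend S Y))
baseIndex (true ∷ S) Y zero = zero
baseIndex (true ∷ S) Y (suc k) = suc (baseIndex S Y k)
baseIndex (false ∷ S) (true ∷ Y) k = suc (baseIndex S Y k)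
baseIndex (false ∷ S) (false ∷ Y) k = baseIndex S Y k

size-≤-restrictToBase+ : ∀ {n} (S : Subset n) Y I → size I ≤ size (restrictToBase S Y I) + size Y
size-≤-restrictToBase+ [] [] [] = z≤n
size-≤-restrictToBase+ (true ∷ S) Y (true ∷ I) = s≤s (size-≤-restrictToBase+ S Y I)
size-≤-restrictToBase+ (true ∷ S) Y (false ∷ I) = size-≤-restrictToBase+ S Y I
size-≤-restrictToBase+ (false ∷ S) (true ∷ Y) (i ∷ I) = begin
  size (i ∷ I)                               ≤⟨ size-∷-≤ i I ⟩
  suc (size I)                               ≤⟨ s≤s (size-≤-restrictToBase+ S Y I) ⟩
  suc (size (restrictToBase S Y I) + size Y) ≡⟨ +-suc _ _ ⟨
  size (restrictToBase S Y I) + suc (size Y) ∎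
  where
  open ≤-Reasoning
  size-∷-≤ : ∀ b {m} (I : Subset m) → size (b ∷ I) ≤ suc (size I)
  size-∷-≤ true I = ≤-refl
  size-∷-≤ false I = n≤1+n _
size-≤-restrictToBase+ (false ∷ S) (false ∷ Y) I = size-≤-restrictToBase+ S Y I

enum-baseIndex : ∀ {n} (S : Subset n) Y k → enum (extend S Y) (baseIndex S Y k) ≡ enum S k
enum-baseIndex (true ∷ S) Y zero = refl
enum-baseIndex (true ∷ S) Y (suc k) = cong suc (enum-baseIndex S Y k)
enum-baseIndex (false ∷ S) (true ∷ Y) k = cong suc (enum-baseIndex S Y k)
enum-baseIndex (false ∷ S) (false ∷ Y) k = cong suc (enum-baseIndex S Y k)

lookup-restrictToBase : ∀ {n} (S : Subset n) Y I k →
  lookup (restrictToBase S Y I) k ≡ lookup I (baseIndex S Y k)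
lookup-restrictToBase (true ∷ S) Y (i ∷ I) zero = refl
lookup-restrictToBase (true ∷ S) Y (i ∷ I) (suc k) = lookup-restrictToBase S Y I k
lookup-restrictToBase (false ∷ S) (true ∷ Y) (i ∷ I) k = lookup-restrictToBase S Y I k
lookup-restrictToBase (false ∷ S) (false ∷ Y) I k = lookup-restrictToBase S Y I k

Independent-restrictToBase : ∀ {n} (G : Graph n) S Y I →
  Independent (induced G (extend S Y)) I → Independent (induced G S) (restrictToBase S Y I)
Independent-restrictToBase G S Y I indep k l Ik Il =
  subst₂ (λ u v → adj G u v ≡ false) (enum-baseIndex S Y k) (enum-baseIndex S Y l)
    (indep (baseIndex S Y k) (baseIndex S Y l)
      (trans (sym (lookup-restrictToBase S Y I k)) Ik)
      (trans (sym (lookup-restrictToBase S Y I l)) Il))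

α-extend-≤ : ∀ {n} (G : Graph n) S Y → α (induced G (extend S Y)) ≤ α (induced G S) + size Y
α-extend-≤ G S Y = α-≤ (induced G (extend S Y)) λ I indep →
  ≤-trans (size-≤-restrictToBase+ S Y I)
    (+-monoˡ-≤ (size Y)
      (size≤α (induced G S) (restrictToBase S Y I) (Independent-restrictToBase G S Y I indep)))

-- lift T Z is Z ⊆ T viewed as a subset of the whole vertex set.
lift : ∀ {n} (T : Subset n) → Subset (size T) → Subset n
lift [] [] = []
lift (true ∷ T) (z ∷ Z) = z ∷ lift T Z
lift (false ∷ T) Z = false ∷ lift T Z

size-lift : ∀ {n} (T : Subset n) Z → size Z ≡ size (lift T Z)
size-lift [] [] = refl
size-lift (true ∷ T) (true ∷ Z) = cong suc (size-lift T Z)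
size-lift (true ∷ T) (false ∷ Z) = size-lift T Z
size-lift (false ∷ T) Z = size-lift T Z

enum-lift : ∀ {n} (T : Subset n) Z .(e : size Z ≡ size (lift T Z)) (i : Fin (size Z)) →
  enum (lift T Z) (cast e i) ≡ enum T (enum Z i)
enum-lift [] [] e ()
enum-lift (true ∷ T) (true ∷ Z) e zero = refl
enum-lift (true ∷ T) (true ∷ Z) e (suc i) = cong suc (enum-lift T Z (cong pred e) i)
enum-lift (true ∷ T) (false ∷ Z) e i = cong suc (enum-lift T Z e i)
enum-lift (false ∷ T) Z e i = cong suc (enum-lift T Z e i)

complement-extend : ∀ {n} (S : Subset n) Y →
  complement (extend S Y) ≡ lift (complement S) (complement Y)
complement-extend [] [] = refl
complement-extend (true ∷ S) Y = cong (false ∷_) (complement-extend S Y)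
complement-extend (false ∷ S) (y ∷ Y) = cong (not y ∷_) (complement-extend S Y)

-- restrict T Y is Y ∩ T viewed as a subset of T.
restrict : ∀ {n} (T : Subset n) → Subset n → Subset (size T)
restrict [] [] = []
restrict (true ∷ T) (y ∷ Y) = y ∷ restrict T Y
restrict (false ∷ T) (y ∷ Y) = restrict T Y

lift-restrict : ∀ {n} (T Y : Subset n) → lift T (restrict T Y) ≡ zipWith _∧_ T Y
lift-restrict [] [] = refl
lift-restrict (true ∷ T) (y ∷ Y) = cong (y ∷_) (lift-restrict T Y)
lift-restrict (false ∷ T) (y ∷ Y) = cong (false ∷_) (lift-restrict T Y)

complement-restrict : ∀ {n} (T Y : Subset n) → complement (restrict T Y) ≡ restrict T (complement Y)
complement-restrict [] [] = refl
complement-restrict (true ∷ T) (y ∷ Y) = cong (not y ∷_) (complement-restrict T Y)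
complement-restrict (false ∷ T) (y ∷ Y) = complement-restrict T Y

size-restrict-≤ : ∀ {n} (T Y : Subset n) → size (restrict T Y) ≤ size Y
size-restrict-≤ [] [] = z≤n
size-restrict-≤ (true ∷ T) (true ∷ Y) = s≤s (size-restrict-≤ T Y)
size-restrict-≤ (true ∷ T) (false ∷ Y) = size-restrict-≤ T Y
size-restrict-≤ (false ∷ T) (true ∷ Y) = m≤n⇒m≤1+n (size-restrict-≤ T Y)
size-restrict-≤ (false ∷ T) (false ∷ Y) = size-restrict-≤ T Y

lift-complement-restrict : ∀ {n} (X Y : Subset n) →
  lift X (complement (restrict X Y)) ≡ lift (complement Y) (restrict (complement Y) X)
lift-complement-restrict X Y = begin
  lift X (complement (restrict X Y))              ≡⟨ cong (lift X) (complement-restrict X Y) ⟩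
  lift X (restrict X (complement Y))              ≡⟨ lift-restrict X (complement Y) ⟩
  zipWith _∧_ X (complement Y)                    ≡⟨ zipWith-comm ∧-comm X (complement Y) ⟩
  zipWith _∧_ (complement Y) X                    ≡⟨ lift-restrict (complement Y) X ⟨
  lift (complement Y) (restrict (complement Y) X) ∎
  where open ≡-Reasoning

evalLam-extend-≤ : ∀ λ' {n} (G : Graph n) S Y → evalLam λ' G (extend S Y) ≤ size Y + evalLam λ' G S
evalLam-extend-≤ card G S Y = ≤-reflexive (trans (size-extend S Y) (+-comm (size S) (size Y)))
evalLam-extend-≤ alpha G S Y = ≤-trans (α-extend-≤ G S Y) (≤-reflexive (+-comm _ (size Y)))

InducedMonotone : Param → Set
InducedMonotone σ = ∀ {n} (G : Graph n) (X : Subset n) → σ (induced G X) ≤ σ G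

module _ (η : BasicHyperparameter) (ic : IsoCompatible η) where

  private
    SameSet-image-id : ∀ {m} {H H' : Hypergraph m} →
      SameSet H' (List⁺.map (imageSub (↔-id (Fin m))) H) → SameSet H' H
    SameSet-image-id {H = H} = subst (SameSet _) (trans (map-cong tabulate∘lookup H) (map-id H))

    maxSize minSize : ∀ {m} → Hypergraph m → ℕ
    maxSize H = foldr₁ _⊔_ (List⁺.map size H)
    minSize H = foldr₁ _⊓_ (List⁺.map size H)

  -- Graphs with equal adjacency may still differ in their proof fields, hence the
  -- appeal to iso-compatibility for the identity permutation.
  val-≤-sameAdj : ∀ {m} (A B : Graph m) → (∀ i j → adj A i j ≡ adj B i j) → val η A ≤ val η B
  val-≤-sameAdj {m} A B A≡B with opt η | ic (record { π = ↔-id (Fin m) ; preserve = A≡B })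
  ... | minmax | _ , fromB with foldr₁-attained maxSize ⊓-sel (F η B)
  ...   | H' , H'∈ , valB≡ with fromB H'∈
  ...     | H , H∈ , H'≈H =
    ≤-trans (foldr₁-⊓-≤ maxSize (F η A) H∈)
      (≤-trans (foldr₁-⊔-mono-⊆ size {H} {H'} (proj₂ (SameSet-image-id H'≈H)))
        (≤-reflexive (sym valB≡)))
  val-≤-sameAdj {m} A B A≡B | maxmin | toB , _ with foldr₁-attained minSize ⊔-sel (F η A)
  ...   | H , H∈ , valA≡ with toB H∈
  ...     | H' , H'∈ , H'≈H =
    ≤-trans (≤-reflexive valA≡)
      (≤-trans (foldr₁-⊓-antimono-⊆ size {H'} {H} (proj₁ (SameSet-image-id H'≈H)))
        (≤-foldr₁-⊔ minSize (F η B) H'∈))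

  val-cong : ∀ {m m'} (A : Graph m) (B : Graph m') (e : m ≡ m') →
    (∀ i j → adj A i j ≡ adj B (cast e i) (cast e j)) → val η A ≡ val η B
  val-cong A B refl A≡B =
    ≤-antisym (val-≤-sameAdj A B A≡B′) (val-≤-sameAdj B A (λ i j → sym (A≡B′ i j)))
    where
    A≡B′ : ∀ i j → adj A i j ≡ adj B i j
    A≡B′ i j = trans (A≡B i j) (cong₂ (adj B) (cast-is-id refl i) (cast-is-id refl j))

  val-induced-induced : ∀ {n} (G : Graph n) T Z →
    val η (induced (induced G T) Z) ≡ val η (induced G (lift T Z))
  val-induced-induced G T Z = val-cong _ _ (size-lift T Z) λ i j →
    sym (cong₂ (adj G) (enum-lift T Z (size-lift T Z) i) (enum-lift T Z (size-lift T Z) j))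

  μ-inheritable : ∀ d → Inheritable (μ (val η) d)
  μ-inheritable d λ' G S with μ-attained (val η) d (G ─ S) card (fullSet-isModulator η d (G ─ S))
  ... | Y , Y-mod , ρ≡ =
    ≤-trans (μ-≤ (val η) d G λ' extend-isModulator)
      (subst (λ k → evalLam λ' G (extend S Y) ≤ k + evalLam λ' G S) (sym ρ≡)
        (evalLam-extend-≤ λ' G S Y))
    where
    open ≤-Reasoning
    extend-isModulator : val η (G ─ extend S Y) ≤ d
    extend-isModulator = begin
      val η (G ─ extend S Y)
        ≡⟨ cong (λ X → val η (induced G X)) (complement-extend S Y) ⟩
      val η (induced G (lift (complement S) (complement Y)))
        ≡⟨ val-induced-induced G (complement S) (complement Y) ⟨
      val η ((G ─ S) ─ Y)
        ≤⟨ Y-mod ⟩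
      d ∎

  μ-monotone : InducedMonotone (val η) → ∀ d → InducedMonotone (val (μ (val η) d))
  μ-monotone mono d G X with μ-attained (val η) d G card (fullSet-isModulator η d G)
  ... | Y , Y-mod , ρ≡ = begin
    val (μ (val η) d) (induced G X) ≤⟨ μ-≤ (val η) d (induced G X) card restrict-isModulator ⟩
    size (restrict X Y)             ≤⟨ size-restrict-≤ X Y ⟩
    size Y                          ≡⟨ ρ≡ ⟨
    val (μ (val η) d) G             ∎
    where
    open ≤-Reasoning
    restrict-isModulator : val η (induced G X ─ restrict X Y) ≤ d
    restrict-isModulator = begin
      val η (induced G X ─ restrict X Y)
        ≡⟨ val-induced-induced G X _ ⟩
      val η (induced G (lift X (complement (restrict X Y))))
        ≡⟨ cong (λ Z → val η (induced G Z)) (lift-complement-restrict X Y) ⟩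
      val η (induced G (lift (complement Y) (restrict (complement Y) X)))
        ≡⟨ val-induced-induced G _ _ ⟨
      val η (induced (G ─ Y) (restrict (complement Y) X))
        ≤⟨ mono (G ─ Y) _ ⟩
      val η (G ─ Y)
        ≤⟨ Y-mod ⟩
      d ∎

μ-unbounded : (η : BasicHyperparameter) → Inheritable η → Heavy η → ∀ d k →
  Σ ℕ λ n → Σ (Graph n) λ G → IsComplete G × k < val (μ (val η) d) G
μ-unbounded η inh (_ , unbounded) d k with unbounded (k + d)
... | n , G , complete , k+d<η with μ-attained (val η) d G card (fullSet-isModulator η d G)
...   | Y , Y-mod , ρ≡ =
  n , G , complete , subst (k <_) (sym ρ≡) (+-cancelʳ-≤ d (suc k) (size Y) k+d<Y+d)
  where
  open ≤-Reasoning
  k+d<Y+d : suc k + d ≤ size Y + d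
  k+d<Y+d = begin
    suc k + d              ≤⟨ k+d<η ⟩
    val η G                ≤⟨ inh card G Y ⟩
    val η (G ─ Y) + size Y ≤⟨ +-monoˡ-≤ (size Y) Y-mod ⟩
    d + size Y             ≡⟨ +-comm d (size Y) ⟩
    size Y + d             ∎

value-≤-+-μ : (σ : BasicHyperparameter) → Inheritable σ → ∀ λ' c {n} (G : Graph n) →
  value λ' σ G ≤ c + value λ' (μ (val σ) c) G
value-≤-+-μ σ inh λ' c G with μ-attained (val σ) c G λ' (fullSet-isModulator σ c G)
... | S , S-mod , μ≡ = ≤-trans (inh λ' G S) (+-mono-≤ S-mod (≤-reflexive (sym μ≡)))

module _ (η : BasicHyperparameter) (mono : InducedMonotone (val η)) (d : ℕ) where

  μ-vanishes : ∀ {n} (G : Graph n) → val η G ≤ d → val (μ (val η) d) G ≤ 0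
  μ-vanishes {n} G η≤d =
    subst (val (μ (val η) d) G ≤_) (size-emptySet n)
      (μ-≤ (val η) d G card {emptySet n} (≤-trans (mono G _) η≤d))

  μ₀-μ-≤ : ∀ λ' {n} (G : Graph n) → value λ' (μ (val (μ (val η) d)) 0) G ≤ value λ' (μ (val η) d) G
  μ₀-μ-≤ λ' G with μ-attained (val η) d G λ' (fullSet-isModulator η d G)
  ... | S , S-mod , ρ≡ = subst (value λ' (μ (val (μ (val η) d)) 0) G ≤_) (sym ρ≡)
    (μ-≤ (val (μ (val η) d)) 0 G λ' (μ-vanishes (G ─ S) S-mod))

module _ {σ τ : Param} (c : ℕ) (σ≤c+τ : ∀ {n} (G : Graph n) → σ G ≤ c + τ G) (𝒢 : GraphClass) where

  Bounded-transfer : Bounded τ 𝒢 → Bounded σ 𝒢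
  Bounded-transfer (k , τ≤k) =
    c + k , λ G G∈ X → ≤-trans (σ≤c+τ (induced G X)) (+-monoʳ-≤ c (τ≤k G G∈ X))

  CliqueBounded-transfer : CliqueBounded τ 𝒢 → CliqueBounded σ 𝒢
  CliqueBounded-transfer (f , f-mono , τ≤f) =
    (λ w → c + f w) , (λ a≤b → +-monoʳ-≤ c (f-mono a≤b)) ,
    λ G G∈ X → ≤-trans (σ≤c+τ (induced G X)) (+-monoʳ-≤ c (τ≤f G G∈ X))

proposition5p19 : (η : BasicHyperparameter) → IsoCompatible η → Inheritable η → Heavy η →
    (d : ℕ) →
    Inheritable (μ (val η) d) × Heavy (μ (val η) d)
    × (∀ (𝒢 : GraphClass) → Bounded (value alpha (μ (val η) d)) 𝒢
         ⇔ Σ ℕ (λ c → Bounded (value alpha (μ (val (μ (val η) d)) c)) 𝒢))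
    × (∀ (𝒢 : GraphClass) → CliqueBounded (val (μ (val η) d)) 𝒢
         ⇔ Σ ℕ (λ c → CliqueBounded (val (μ (val (μ (val η) d)) c)) 𝒢))
proposition5p19 η ic inh heavy@(mono , _) d =
    ρ-inheritable
  , (μ-monotone η ic mono d , μ-unbounded η inh heavy d)
  , (λ 𝒢 → mk⇔ (λ b → 0 , Bounded-transfer 0 (μ₀-μ-≤ η mono d alpha) 𝒢 b)
               (λ (c , b) → Bounded-transfer c (value-≤-+-μ ρ ρ-inheritable alpha c) 𝒢 b))
  , (λ 𝒢 → mk⇔ (λ b → 0 , CliqueBounded-transfer 0 (μ₀-μ-≤ η mono d card) 𝒢 b)
               (λ (c , b) → CliqueBounded-transfer c (value-≤-+-μ ρ ρ-inheritable card c) 𝒢 b))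
  where
  ρ : BasicHyperparameter
  ρ = μ (val η) d
  ρ-inheritable : Inheritable ρ
  ρ-inheritable = μ-inheritable η ic d
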